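{- Let $n,m\ge1$, $c\ge1$, $r,s,R,S\ge0$ be integers and $\alpha\in\mathrm{Par}(R,r)$, $\beta\in\mathrm{Par}(S,s)$, $\lambda\in\mathrm{Par}(n-R,c)$, $\mu\in\mathrm{Par}(m-S,c)$. Then \[ X(q)=\frac{[(n-R)(m-S)]_q}{[c]_q}\begin{bmatrix} n\\ r\end{bmatrix}_q\begin{bmatrix} m\\ s\end{bmatrix}_q\begin{bmatrix} r\\ \alpha\end{bmatrix}_q\begin{bmatrix} s\\ \beta\end{bmatrix}_q\begin{bmatrix} c\\ \lambda\end{bmatrix}_q\begin{bmatrix} c\\ \mu\end{bmatrix}_q \] is a polynomial in $q$.
   Context: $\mathrm{Par}(N,k)$ is the set of partitions of $N$ with exactly $k$ parts; $\lambda=(1^{m_1},2^{m_2},\dots)$ has $m_i$ parts equal to $i$. $[N]_q=\frac{1-q^N}{1-q}$, $[N]_q!=[1]_q\cdots[N]_q$, $\begin{bmatrix} N\\ k\end{bmatrix}_q=\frac{[N]_q!}{[k]_q![N-k]_q!}$ ($0\le k\le N$), and for $\lambda$ with $k$ parts $\begin{bmatrix} k\\ \lambda\end{bmatrix}_q=\frac{[k]_q!}{[m_1]_q![m_2]_q!\cdots}$. -}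

module Defs where

open import Data.Nat using (ℕ; zero; suc; _∸_; _≟_)
open import Data.Integer as ℤ using (ℤ; +_)
open import Data.List using (List; []; _∷_; replicate; length; map; upTo; foldr)
open import Data.Nat.ListAction using (sum)
open import Data.List.Relation.Unary.All using (All)
open import Data.List.Relation.Unary.Linked using (Linked)
open import Relation.Nullary using (yes; no)
open import Data.Product using (_×_; _,_; ∃-syntax)
open import Relation.Binary.PropositionalEquality using (_≡_)

-- Polynomials in q with integer coefficients, as coefficient lists
-- (constant term first).  Trailing zeros are allowed; equality is
-- coefficientwise (_≈P_).
Poly : Set
Poly = List ℤ

coeff : ℕ → Poly → ℤ
coeff _       []       = + 0
coeff zero    (a ∷ _)  = a
coeff (suc k) (_ ∷ p)  = coeff k p

_≈P_ : Poly → Poly → Set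
p ≈P p' = ∀ k → coeff k p ≡ coeff k p'

_+P_ : Poly → Poly → Poly
[]      +P p'       = p'
p       +P []       = p
(a ∷ p) +P (b ∷ p') = (a ℤ.+ b) ∷ (p +P p')

scale : ℤ → Poly → Poly
scale a = map (a ℤ.*_)

_*P_ : Poly → Poly → Poly
[]      *P _  = []
(a ∷ p) *P p' = scale a p' +P (+ 0 ∷ (p *P p'))

oneP : Poly
oneP = + 1 ∷ []

prodP : List Poly → Poly
prodP = foldr _*P_ oneP

qint : ℕ → Poly
qint N = replicate N (+ 1)

qfact : ℕ → Poly
qfact zero    = oneP
qfact (suc N) = qint (suc N) *P qfact N

-- Formal quotients num / den of polynomials
QFrac : Set
QFrac = Poly × Poly

_*F_ : QFrac → QFrac → QFrac
(a , b) *F (c , d) = (a *P c) , (b *P d)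

qbinom : ℕ → ℕ → QFrac
qbinom N k = qfact N , (qfact k *P qfact (N ∸ k))

mult : ℕ → List ℕ → ℕ
mult i []        = 0
mult i (x ∷ lam) with x ≟ i
... | yes _ = suc (mult i lam)
... | no  _ = mult i lam

-- Π_{i ≥ 1} [m_i]_q!  (indices beyond sum lam have m_i = 0, [0]_q! = 1;
-- i = 0 has m_0 = 0 for partitions)
multFact : List ℕ → Poly
multFact lam = prodP (map (λ i → qfact (mult i lam)) (upTo (suc (sum lam))))

qmultinom : ℕ → List ℕ → QFrac
qmultinom k lam = qfact k , multFact lam

record IsPar (N k : ℕ) (lam : List ℕ) : Set where
  field
    decreasing : Linked (λ a b → b Data.Nat.≤ a) lam
    positive   : All (λ x → 1 Data.Nat.≤ x) lam
    total      : sum lam ≡ N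
    nparts     : length lam ≡ k

-- A quotient num/den (den a nonzero monic polynomial here) is a polynomial
IsPolynomial : QFrac → Set
IsPolynomial (num , den) = ∃[ Q ] ((Q *P den) ≈P num)

X : (n m c r s R S : ℕ) (α β lam μ : List ℕ) → QFrac
X n m c r s R S α β lam μ =
  (qint ((n ∸ R) Data.Nat.* (m ∸ S)) , qint c)
  *F (qbinom n r *F (qbinom m s *F (qmultinom r α *F (qmultinom s β
  *F (qmultinom c lam *F qmultinom c μ)))))

module Submission where

-- Writing it as
--   [n r]·[m s]·[r α]·[s β]·[c μ] · ([(n-R)(m-S)]/[c])·[c λ],
-- each factor is shown to be a polynomial, i.e. its denominator divides
-- its numerator in ℤ[q]; divisibility is multiplicative, so X(q) is one.
--   * Polynomials (coefficient lists up to coefficientwise equality) form a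
--     commutative semiring, so the ring solver handles all rearrangements.
--   * q-Pascal:  [a]![b]! ∣ [a+b]!, hence Π[f]! ∣ [Σ f]!  (binomials,
--     multinomials).
--   * The only non-standard factor: for a partition λ with c parts and
--     multiplicities m_i, [c]·Π[m_i]! ∣ [e]·[c]! for e = each m_i (the
--     multinomial with one m_i lowered); since [a+b] = [a] + q^a[b] the
--     admissible e are closed under sums and multiples, and
--     (n-R)(m-S) = (m-S)·Σ_i i·m_i is such a combination.
--   * Counting parts by multiplicity (WeightedCount) gives Σ_i m_i = c and
--     Σ_i i·m_i = |λ|, linking multFact to these statements.

open import Defs
open import Level using (0ℓ)
open import Data.Nat as ℕ using (ℕ; zero; suc; _≤_; _<_; _∸_; _≟_; s≤s; z≤n)
import Data.Nat.Properties as ℕP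
open import Data.Integer as ℤ using (+_)
import Data.Integer.Properties as ℤP
open import Data.Integer.Tactic.RingSolver as ℤ-Solver using ()
open import Data.List using (List; []; _∷_; [_]; map; upTo; length; _++_)
open import Data.List.Properties using (map-cong; map-∘; map-id; map-++; upTo-∷ʳ)
open import Data.Nat.ListAction using (sum)
open import Data.Nat.ListAction.Properties using (sum-++)
open import Data.List.Relation.Unary.All as All using (All; []; _∷_)
import Data.List.Relation.Unary.All.Properties as All
open import Data.List.Membership.Propositional using (_∈_)
open import Data.List.Membership.Propositional.Properties using (∈-∃++)
open import Data.Maybe using (nothing)
open import Data.Product using (Σ; _,_)
open import Algebra.Bundles using (CommutativeSemiring)
open import Algebra.Structures.Biased using (isCommutativeSemiringˡ; isCommutativeMonoidˡ)
open import Algebra.Properties.CommutativeSemigroup ℕP.+-commutativeSemigroup using ()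
  renaming (x∙yz≈y∙xz to +-left-comm; interchange to +-interchange)
open import Relation.Binary.Structures using (IsEquivalence)
open import Relation.Nullary using (yes; no; ¬_; contradiction)
open import Relation.Binary.PropositionalEquality
  using (_≡_; refl; sym; trans; cong; cong₂; subst; subst₂; module ≡-Reasoning)
open import Tactic.RingSolver.Core.AlmostCommutativeRing using (AlmostCommutativeRing; fromCommutativeSemiring)
open import Tactic.RingSolver using (solve-∀)

-- Coefficientwise equality, wrapped in a record so that Agda can infer
-- the two polynomials from an equality proof.
infix 4 _≋_
record _≋_ (p p' : Poly) : Set where
  constructor ⟨_⟩
  field at : p ≈P p'
open _≋_

≋-refl : ∀ {p} → p ≋ p
≋-refl = ⟨ (λ _ → refl) ⟩

≋-sym : ∀ {p p'} → p ≋ p' → p' ≋ p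
≋-sym ⟨ e ⟩ = ⟨ (λ k → sym (e k)) ⟩

≋-trans : ∀ {p p' p''} → p ≋ p' → p' ≋ p'' → p ≋ p''
≋-trans ⟨ e ⟩ ⟨ f ⟩ = ⟨ (λ k → trans (e k) (f k)) ⟩

≋-isEquivalence : IsEquivalence _≋_
≋-isEquivalence = record { refl = ≋-refl ; sym = ≋-sym ; trans = ≋-trans }

∷-cong : ∀ {a b p p'} → a ≡ b → p ≋ p' → (a ∷ p) ≋ (b ∷ p')
∷-cong a≡b ⟨ e ⟩ = ⟨ (λ { zero → a≡b ; (suc k) → e k }) ⟩

coeff-+ : ∀ k p p' → coeff k (p +P p') ≡ coeff k p ℤ.+ coeff k p'
coeff-+ k       []      p'       = sym (ℤP.+-identityˡ _)
coeff-+ k       (a ∷ p) []       = sym (ℤP.+-identityʳ _)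
coeff-+ zero    (a ∷ p) (b ∷ p') = refl
coeff-+ (suc k) (a ∷ p) (b ∷ p') = coeff-+ k p p'

coeff-scale : ∀ k a p → coeff k (scale a p) ≡ a ℤ.* coeff k p
coeff-scale k       a []      = sym (ℤP.*-zeroʳ a)
coeff-scale zero    a (x ∷ p) = refl
coeff-scale (suc k) a (x ∷ p) = coeff-scale k a p

coeff-shift-scale : ∀ k a p → coeff k (+ 0 ∷ scale a p) ≡ a ℤ.* coeff k (+ 0 ∷ p)
coeff-shift-scale zero    a p = sym (ℤP.*-zeroʳ a)
coeff-shift-scale (suc k) a p = coeff-scale k a p

coeff-*P : ∀ k a p p' → coeff k ((a ∷ p) *P p') ≡ a ℤ.* coeff k p' ℤ.+ coeff k (+ 0 ∷ (p *P p'))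
coeff-*P k a p p' = trans (coeff-+ k (scale a p') (+ 0 ∷ (p *P p')))
                          (cong (ℤ._+ coeff k (+ 0 ∷ (p *P p'))) (coeff-scale k a p'))

+P-cong : ∀ {p p' r r'} → p ≋ p' → r ≋ r' → (p +P r) ≋ (p' +P r')
+P-cong {p} {p'} {r} {r'} ⟨ e ⟩ ⟨ f ⟩ = ⟨ (λ k → begin
  coeff k (p +P r)           ≡⟨ coeff-+ k p r ⟩
  coeff k p ℤ.+ coeff k r    ≡⟨ cong₂ ℤ._+_ (e k) (f k) ⟩
  coeff k p' ℤ.+ coeff k r'  ≡⟨ coeff-+ k p' r' ⟨
  coeff k (p' +P r')         ∎) ⟩
  where open ≡-Reasoning

+P-comm : ∀ p r → (p +P r) ≋ (r +P p)
+P-comm p r = ⟨ (λ k → begin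
  coeff k (p +P r)         ≡⟨ coeff-+ k p r ⟩
  coeff k p ℤ.+ coeff k r  ≡⟨ ℤP.+-comm (coeff k p) (coeff k r) ⟩
  coeff k r ℤ.+ coeff k p  ≡⟨ coeff-+ k r p ⟨
  coeff k (r +P p)         ∎) ⟩
  where open ≡-Reasoning

+P-assoc : ∀ p r t → ((p +P r) +P t) ≋ (p +P (r +P t))
+P-assoc p r t = ⟨ (λ k → begin
  coeff k ((p +P r) +P t)                   ≡⟨ coeff-+ k (p +P r) t ⟩
  coeff k (p +P r) ℤ.+ coeff k t            ≡⟨ cong (ℤ._+ coeff k t) (coeff-+ k p r) ⟩
  coeff k p ℤ.+ coeff k r ℤ.+ coeff k t     ≡⟨ ℤP.+-assoc (coeff k p) (coeff k r) (coeff k t) ⟩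
  coeff k p ℤ.+ (coeff k r ℤ.+ coeff k t)   ≡⟨ cong (ℤ._+_ (coeff k p)) (coeff-+ k r t) ⟨
  coeff k p ℤ.+ coeff k (r +P t)            ≡⟨ coeff-+ k p (r +P t) ⟨
  coeff k (p +P (r +P t))                   ∎) ⟩
  where open ≡-Reasoning

*P-congˡ : ∀ p {r r'} → r ≋ r' → (p *P r) ≋ (p *P r')
*P-congˡ []      e = ≋-refl
*P-congˡ (a ∷ p) {r} {r'} e = ⟨ (λ k → begin
  coeff k ((a ∷ p) *P r)                            ≡⟨ coeff-*P k a p r ⟩
  a ℤ.* coeff k r ℤ.+ coeff k (+ 0 ∷ (p *P r))      ≡⟨ cong₂ (λ x y → a ℤ.* x ℤ.+ y) (at e k)
                                                         (at (∷-cong refl (*P-congˡ p e)) k) ⟩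
  a ℤ.* coeff k r' ℤ.+ coeff k (+ 0 ∷ (p *P r'))    ≡⟨ coeff-*P k a p r' ⟨
  coeff k ((a ∷ p) *P r')                           ∎) ⟩
  where open ≡-Reasoning

*P-zeroʳ : ∀ p → (p *P []) ≋ []
*P-zeroʳ []      = ≋-refl
*P-zeroʳ (a ∷ p) = ⟨ (λ { zero → refl ; (suc k) → at (*P-zeroʳ p) k }) ⟩

*P-∷ʳ : ∀ p b r → (p *P (b ∷ r)) ≋ (scale b p +P (+ 0 ∷ (p *P r)))
*P-∷ʳ []      b r = ⟨ (λ { zero → refl ; (suc k) → refl }) ⟩
*P-∷ʳ (a ∷ p) b r = ⟨ (λ { zero → cong (ℤ._+ + 0) (ℤP.*-comm a b) ; (suc k) → step k }) ⟩
  where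
  open ≡-Reasoning
  swap : ∀ x y z w v → x ℤ.* y ℤ.+ (z ℤ.* w ℤ.+ v) ≡ z ℤ.* w ℤ.+ (x ℤ.* y ℤ.+ v)
  swap = ℤ-Solver.solve-∀
  step : ∀ k → coeff k (scale a r +P (p *P (b ∷ r))) ≡ coeff k (scale b p +P ((a ∷ p) *P r))
  step k = begin
    coeff k (scale a r +P (p *P (b ∷ r)))
      ≡⟨ coeff-+ k (scale a r) _ ⟩
    coeff k (scale a r) ℤ.+ coeff k (p *P (b ∷ r))
      ≡⟨ cong₂ ℤ._+_ (coeff-scale k a r) (at (*P-∷ʳ p b r) k) ⟩
    a ℤ.* coeff k r ℤ.+ coeff k (scale b p +P (+ 0 ∷ (p *P r)))
      ≡⟨ cong (ℤ._+_ (a ℤ.* coeff k r)) (trans (coeff-+ k (scale b p) _) (cong (ℤ._+ _) (coeff-scale k b p))) ⟩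
    a ℤ.* coeff k r ℤ.+ (b ℤ.* coeff k p ℤ.+ coeff k (+ 0 ∷ (p *P r)))
      ≡⟨ swap a (coeff k r) b (coeff k p) _ ⟩
    b ℤ.* coeff k p ℤ.+ (a ℤ.* coeff k r ℤ.+ coeff k (+ 0 ∷ (p *P r)))
      ≡⟨ cong₂ ℤ._+_ (coeff-scale k b p) (coeff-*P k a p r) ⟨
    coeff k (scale b p) ℤ.+ coeff k ((a ∷ p) *P r)
      ≡⟨ coeff-+ k (scale b p) _ ⟨
    coeff k (scale b p +P ((a ∷ p) *P r)) ∎

shift-*P : ∀ s t → ((+ 0 ∷ s) *P t) ≋ (+ 0 ∷ (s *P t))
shift-*P s t = ⟨ (λ k → trans (coeff-*P k (+ 0) s t) (ℤP.+-identityˡ _)) ⟩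

*P-comm : ∀ p r → (p *P r) ≋ (r *P p)
*P-comm p []      = *P-zeroʳ p
*P-comm p (b ∷ r) = ≋-trans (*P-∷ʳ p b r) (+P-cong (≋-refl {scale b p}) (∷-cong refl (*P-comm p r)))

*P-cong : ∀ {p p' r r'} → p ≋ p' → r ≋ r' → (p *P r) ≋ (p' *P r')
*P-cong {p} {p'} {r} {r'} e f =
  ≋-trans (*P-congˡ p f) (≋-trans (*P-comm p r') (≋-trans (*P-congˡ r' e) (*P-comm r' p')))

*P-distribʳ : ∀ p r t → ((r +P t) *P p) ≋ ((r *P p) +P (t *P p))
*P-distribʳ p []      t       = ≋-refl
*P-distribʳ p (a ∷ r) []      = ≋-sym ⟨ (λ k → trans (coeff-+ k ((a ∷ r) *P p) []) (ℤP.+-identityʳ _)) ⟩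
*P-distribʳ p (a ∷ r) (b ∷ t) = ⟨ (λ k → begin
  coeff k (((a ℤ.+ b) ∷ (r +P t)) *P p)
    ≡⟨ coeff-*P k (a ℤ.+ b) (r +P t) p ⟩
  (a ℤ.+ b) ℤ.* coeff k p ℤ.+ coeff k (+ 0 ∷ ((r +P t) *P p))
    ≡⟨ cong (ℤ._+_ ((a ℤ.+ b) ℤ.* coeff k p))
            (trans (at (∷-cong refl (*P-distribʳ p r t)) k) (coeff-+ k (+ 0 ∷ (r *P p)) (+ 0 ∷ (t *P p)))) ⟩
  (a ℤ.+ b) ℤ.* coeff k p ℤ.+ (coeff k (+ 0 ∷ (r *P p)) ℤ.+ coeff k (+ 0 ∷ (t *P p)))
    ≡⟨ interchange a b (coeff k p) _ _ ⟩
  (a ℤ.* coeff k p ℤ.+ coeff k (+ 0 ∷ (r *P p))) ℤ.+ (b ℤ.* coeff k p ℤ.+ coeff k (+ 0 ∷ (t *P p)))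
    ≡⟨ cong₂ ℤ._+_ (coeff-*P k a r p) (coeff-*P k b t p) ⟨
  coeff k ((a ∷ r) *P p) ℤ.+ coeff k ((b ∷ t) *P p)
    ≡⟨ coeff-+ k ((a ∷ r) *P p) ((b ∷ t) *P p) ⟨
  coeff k (((a ∷ r) *P p) +P ((b ∷ t) *P p)) ∎) ⟩
  where
  open ≡-Reasoning
  interchange : ∀ a b x u v → (a ℤ.+ b) ℤ.* x ℤ.+ (u ℤ.+ v) ≡ (a ℤ.* x ℤ.+ u) ℤ.+ (b ℤ.* x ℤ.+ v)
  interchange = ℤ-Solver.solve-∀

scale-*P : ∀ a p r → (scale a p *P r) ≋ scale a (p *P r)
scale-*P a []      r = ≋-refl
scale-*P a (b ∷ p) r = ⟨ (λ k → begin
  coeff k ((a ℤ.* b ∷ scale a p) *P r)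
    ≡⟨ coeff-*P k (a ℤ.* b) (scale a p) r ⟩
  a ℤ.* b ℤ.* coeff k r ℤ.+ coeff k (+ 0 ∷ (scale a p *P r))
    ≡⟨ cong (ℤ._+_ (a ℤ.* b ℤ.* coeff k r))
            (trans (at (∷-cong refl (scale-*P a p r)) k) (coeff-shift-scale k a (p *P r))) ⟩
  a ℤ.* b ℤ.* coeff k r ℤ.+ a ℤ.* coeff k (+ 0 ∷ (p *P r))
    ≡⟨ factor a b _ _ ⟩
  a ℤ.* (b ℤ.* coeff k r ℤ.+ coeff k (+ 0 ∷ (p *P r)))
    ≡⟨ cong (a ℤ.*_) (coeff-*P k b p r) ⟨
  a ℤ.* coeff k ((b ∷ p) *P r)
    ≡⟨ coeff-scale k a ((b ∷ p) *P r) ⟨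
  coeff k (scale a ((b ∷ p) *P r)) ∎) ⟩
  where
  open ≡-Reasoning
  factor : ∀ a b x y → a ℤ.* b ℤ.* x ℤ.+ a ℤ.* y ≡ a ℤ.* (b ℤ.* x ℤ.+ y)
  factor = ℤ-Solver.solve-∀

*P-assoc : ∀ p r t → ((p *P r) *P t) ≋ (p *P (r *P t))
*P-assoc []      r t = ≋-refl
*P-assoc (a ∷ p) r t =
  ≋-trans (*P-distribʳ t (scale a r) (+ 0 ∷ (p *P r)))
          (+P-cong (scale-*P a r t) (≋-trans (shift-*P (p *P r) t) (∷-cong refl (*P-assoc p r t))))

*P-identityˡ : ∀ p → (oneP *P p) ≋ p
*P-identityˡ p = ⟨ (λ k → begin
  coeff k (oneP *P p)                                ≡⟨ coeff-*P k (+ 1) [] p ⟩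
  + 1 ℤ.* coeff k p ℤ.+ coeff k (+ 0 ∷ [])           ≡⟨ cong₂ ℤ._+_ (ℤP.*-identityˡ (coeff k p)) (coeff-q0 k) ⟩
  coeff k p ℤ.+ + 0                                  ≡⟨ ℤP.+-identityʳ (coeff k p) ⟩
  coeff k p                                          ∎) ⟩
  where
  open ≡-Reasoning
  coeff-q0 : ∀ k → coeff k (+ 0 ∷ []) ≡ + 0
  coeff-q0 zero    = refl
  coeff-q0 (suc k) = refl

-- ℤ[q], presented by coefficient lists, is a commutative semiring; this lets the ring solver
-- normalise polynomial identities below.
polyCommutativeSemiring : CommutativeSemiring 0ℓ 0ℓ
polyCommutativeSemiring = record
  { Carrier = Poly ; _≈_ = _≋_ ; _+_ = _+P_ ; _*_ = _*P_ ; 0# = [] ; 1# = oneP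
  ; isCommutativeSemiring = isCommutativeSemiringˡ record
    { +-isCommutativeMonoid = isCommutativeMonoidˡ record
      { isSemigroup = record
        { isMagma = record { isEquivalence = ≋-isEquivalence ; ∙-cong = +P-cong }
        ; assoc   = +P-assoc }
      ; identityˡ = λ _ → ≋-refl
      ; comm      = +P-comm }
    ; *-isCommutativeMonoid = isCommutativeMonoidˡ record
      { isSemigroup = record
        { isMagma = record { isEquivalence = ≋-isEquivalence ; ∙-cong = *P-cong }
        ; assoc   = *P-assoc }
      ; identityˡ = *P-identityˡ
      ; comm      = *P-comm }
    ; distribʳ = *P-distribʳ
    ; zeroˡ    = λ _ → ≋-refl } }

polyRing : AlmostCommutativeRing 0ℓ 0ℓ
polyRing = fromCommutativeSemiring polyCommutativeSemiring (λ _ → nothing)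

infix 4 _∣P_
_∣P_ : Poly → Poly → Set
d ∣P p = Σ Poly (λ Q → (Q *P d) ≋ p)

divides⇒polynomial : ∀ {num den} → den ∣P num → IsPolynomial (num , den)
divides⇒polynomial (Q , Qden≋num) = Q , at Qden≋num

∣P-resp : ∀ {d d' p p'} → d ≋ d' → p ≋ p' → d ∣P p → d' ∣P p'
∣P-resp e f (Q , Qd≋p) = Q , ≋-trans (*P-cong (≋-refl {Q}) (≋-sym e)) (≋-trans Qd≋p f)

∣P-refl : ∀ d → d ∣P d
∣P-refl d = oneP , *P-identityˡ d

∣P-zero : ∀ d → d ∣P []
∣P-zero d = [] , ≋-refl

∣P-trans : ∀ {d e p} → d ∣P e → e ∣P p → d ∣P p
∣P-trans {d} (Q , Qd≋e) (Q' , Q'e≋p) =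
  (Q' *P Q) , ≋-trans (*P-assoc Q' Q d) (≋-trans (*P-cong (≋-refl {Q'}) Qd≋e) Q'e≋p)

∣P-*-mono : ∀ {d p e r} → d ∣P p → e ∣P r → (d *P e) ∣P (p *P r)
∣P-*-mono {d} {p} {e} {r} (Q , Qd≋p) (Q' , Q'e≋r) =
  (Q *P Q') , ≋-trans (interchange Q Q' d e) (*P-cong Qd≋p Q'e≋r)
  where
  interchange : ∀ x y z w → ((x *P y) *P (z *P w)) ≋ ((x *P z) *P (y *P w))
  interchange = solve-∀ polyRing

∣P-*ˡ : ∀ c {d p} → d ∣P p → (c *P d) ∣P (c *P p)
∣P-*ˡ c = ∣P-*-mono (∣P-refl c)

∣P-multipleˡ : ∀ c {d p} → d ∣P p → d ∣P (c *P p)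
∣P-multipleˡ c {d} (Q , Qd≋p) = (c *P Q) , ≋-trans (*P-assoc c Q d) (*P-cong (≋-refl {c}) Qd≋p)

∣P-+ : ∀ {d p r} → d ∣P p → d ∣P r → d ∣P (p +P r)
∣P-+ {d} (Q , Qd≋p) (Q' , Q'd≋r) = (Q +P Q') , ≋-trans (*P-distribʳ d Q Q') (+P-cong Qd≋p Q'd≋r)

qpow : ℕ → Poly
qpow zero    = oneP
qpow (suc a) = + 0 ∷ qpow a

qint-+ : ∀ a b → qint (a ℕ.+ b) ≋ (qint a +P (qpow a *P qint b))
qint-+ zero    b = ≋-sym (*P-identityˡ (qint b))
qint-+ (suc a) b =
  ≋-trans (∷-cong refl (qint-+ a b)) (+P-cong (≋-refl {qint (suc a)}) (≋-sym (shift-*P (qpow a) (qint b))))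

-- [a]_q! [b]_q! divides [a+b]_q!, by induction along the q-Pascal rule
-- [a+b+2] = [a+1] + q^(a+1) [b+1].
qfact-binomial : ∀ a b → (qfact a *P qfact b) ∣P qfact (a ℕ.+ b)
qfact-binomial zero    b    = ∣P-resp (≋-sym (*P-identityˡ (qfact b))) ≋-refl (∣P-refl (qfact b))
qfact-binomial (suc a) zero =
  subst (λ N → (qfact (suc a) *P oneP) ∣P qfact N) (sym (ℕP.+-identityʳ (suc a)))
        (∣P-resp (≋-sym (*P-identityʳ (qfact (suc a)))) ≋-refl (∣P-refl (qfact (suc a))))
  where
  *P-identityʳ : ∀ x → (x *P oneP) ≋ x
  *P-identityʳ = solve-∀ polyRing
qfact-binomial (suc a) (suc b) = ∣P-resp ≋-refl pascal (∣P-+ left right)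
  where
  A = qint (suc a)
  B = qint (suc b)
  F = qfact (a ℕ.+ suc b)
  D = (A *P qfact a) *P (B *P qfact b)
  left : D ∣P (A *P F)
  left = ∣P-resp (≋-sym (*P-assoc A (qfact a) (B *P qfact b))) ≋-refl
                 (∣P-*ˡ A (qfact-binomial a (suc b)))
  rearrange : ∀ x y z w → (y *P ((x *P z) *P w)) ≋ ((x *P z) *P (y *P w))
  rearrange = solve-∀ polyRing
  right : D ∣P (qpow (suc a) *P (B *P F))
  right = ∣P-multipleˡ (qpow (suc a))
            (subst (λ N → D ∣P (B *P qfact N)) (sym (ℕP.+-suc a b))
              (∣P-resp (rearrange A B (qfact a) (qfact b)) ≋-refl (∣P-*ˡ B (qfact-binomial (suc a) b))))
  collect : ∀ x y z w → ((x *P w) +P (y *P (z *P w))) ≋ ((x +P (y *P z)) *P w)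
  collect = solve-∀ polyRing
  pascal : ((A *P F) +P (qpow (suc a) *P (B *P F))) ≋ qfact (suc a ℕ.+ suc b)
  pascal = ≋-trans (collect A (qpow (suc a)) B F) (*P-cong (≋-sym (qint-+ (suc a) (suc b))) (≋-refl {F}))

qfacts : List ℕ → Poly
qfacts fs = prodP (map qfact fs)

qfacts-∣-qfact-sum : ∀ fs → qfacts fs ∣P qfact (sum fs)
qfacts-∣-qfact-sum []       = ∣P-refl oneP
qfacts-∣-qfact-sum (f ∷ fs) = ∣P-trans (∣P-*ˡ (qfact f) (qfacts-∣-qfact-sum fs)) (qfact-binomial f (sum fs))

-- If e is one of the numbers fs summing to N, then [N]_q Π[f]_q! divides
-- [e]_q [N]_q!: the q-multinomial coefficient times [e]/[N] is again a
-- q-multinomial coefficient (that of fs with e lowered by one).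
qfacts-∣-qint-head : ∀ e rest → (qint (e ℕ.+ sum rest) *P qfacts (e ∷ rest)) ∣P (qint e *P qfact (e ℕ.+ sum rest))
qfacts-∣-qint-head zero    rest = ∣P-zero _
qfacts-∣-qint-head (suc e) rest =
  ∣P-resp (regroup N E (qfact e) (qfacts rest)) (swap N E (qfact (e ℕ.+ sum rest)))
          (∣P-*ˡ (N *P E) (qfacts-∣-qfact-sum (e ∷ rest)))
  where
  N = qint (suc e ℕ.+ sum rest)
  E = qint (suc e)
  regroup : ∀ n x y z → ((n *P x) *P (y *P z)) ≋ (n *P ((x *P y) *P z))
  regroup = solve-∀ polyRing
  swap : ∀ n x y → ((n *P x) *P y) ≋ (x *P (n *P y))
  swap = solve-∀ polyRing

sum-middle : ∀ ys e zs → sum (ys ++ e ∷ zs) ≡ e ℕ.+ sum (ys ++ zs)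
sum-middle []       e zs = refl
sum-middle (y ∷ ys) e zs = trans (cong (y ℕ.+_) (sum-middle ys e zs)) (+-left-comm y e (sum (ys ++ zs)))

qfacts-middle : ∀ ys e zs → qfacts (ys ++ e ∷ zs) ≋ qfacts (e ∷ (ys ++ zs))
qfacts-middle []       e zs = ≋-refl
qfacts-middle (y ∷ ys) e zs =
  ≋-trans (*P-cong (≋-refl {qfact y}) (qfacts-middle ys e zs)) (left-comm (qfact y) (qfact e) (qfacts (ys ++ zs)))
  where
  left-comm : ∀ x y z → (x *P (y *P z)) ≋ (y *P (x *P z))
  left-comm = solve-∀ polyRing

qfacts-∣-qint-part : ∀ fs {e} → e ∈ fs → (qint (sum fs) *P qfacts fs) ∣P (qint e *P qfact (sum fs))
qfacts-∣-qint-part fs {e} e∈fs with ∈-∃++ e∈fs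
... | ys , zs , refl rewrite sum-middle ys e zs =
  ∣P-resp (*P-cong (≋-refl {qint (e ℕ.+ sum (ys ++ zs))}) (≋-sym (qfacts-middle ys e zs))) ≋-refl
          (qfacts-∣-qint-head e (ys ++ zs))

-- For fixed d and F, the set of e with d ∣ [e]_q F contains 0 and is
-- closed under addition (by [a+b] = [a] + q^a [b]); hence it is closed
-- under multiples and finite sums.
module QIntMultiples (d F : Poly) where

  Divides : ℕ → Set
  Divides e = d ∣P (qint e *P F)

  divides-0 : Divides 0
  divides-0 = ∣P-zero d

  divides-+ : ∀ a b → Divides a → Divides b → Divides (a ℕ.+ b)
  divides-+ a b da db = ∣P-resp ≋-refl (≋-sym split) (∣P-+ da (∣P-multipleˡ (qpow a) db))
    where
    distribute : ∀ x y z w → ((x +P (y *P z)) *P w) ≋ ((x *P w) +P (y *P (z *P w)))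
    distribute = solve-∀ polyRing
    split : (qint (a ℕ.+ b) *P F) ≋ ((qint a *P F) +P (qpow a *P (qint b *P F)))
    split = ≋-trans (*P-cong (qint-+ a b) (≋-refl {F})) (distribute (qint a) (qpow a) (qint b) F)

  divides-* : ∀ k e → Divides e → Divides (k ℕ.* e)
  divides-* zero    e de = divides-0
  divides-* (suc k) e de = divides-+ e (k ℕ.* e) de (divides-* k e de)

  divides-sum : ∀ {es} → All Divides es → Divides (sum es)
  divides-sum []                = divides-0
  divides-sum {e ∷ es} (de ∷ des) = divides-+ e (sum es) de (divides-sum des)

mult-∷ : ∀ i x lam → mult i (x ∷ lam) ≡ mult i [ x ] ℕ.+ mult i lam
mult-∷ i x lam with x ≟ i
... | yes _ = refl
... | no  _ = refl

mult-self : ∀ x → mult x [ x ] ≡ 1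
mult-self x with x ≟ x
... | yes _   = refl
... | no  x≢x = contradiction refl x≢x

mult-other : ∀ x i → ¬ x ≡ i → mult i [ x ] ≡ 0
mult-other x i x≢i with x ≟ i
... | yes x≡i = contradiction x≡i x≢i
... | no  _   = refl

sum-upTo-suc : ∀ (f : ℕ → ℕ) K → sum (map f (upTo (suc K))) ≡ sum (map f (upTo K)) ℕ.+ f K
sum-upTo-suc f K = begin
  sum (map f (upTo (suc K)))               ≡⟨ cong (λ is → sum (map f is)) (upTo-∷ʳ K) ⟨
  sum (map f (upTo K ++ [ K ]))            ≡⟨ cong sum (map-++ f (upTo K) [ K ]) ⟩
  sum (map f (upTo K) ++ [ f K ])          ≡⟨ sum-++ (map f (upTo K)) [ f K ] ⟩
  sum (map f (upTo K)) ℕ.+ (f K ℕ.+ 0)     ≡⟨ cong (sum (map f (upTo K)) ℕ.+_) (ℕP.+-identityʳ (f K)) ⟩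
  sum (map f (upTo K)) ℕ.+ f K             ∎
  where open ≡-Reasoning

sum-map-+ : ∀ (f g : ℕ → ℕ) is → sum (map (λ i → f i ℕ.+ g i) is) ≡ sum (map f is) ℕ.+ sum (map g is)
sum-map-+ f g []       = refl
sum-map-+ f g (i ∷ is) =
  trans (cong (f i ℕ.+ g i ℕ.+_) (sum-map-+ f g is)) (+-interchange (f i) (g i) _ _)

module WeightedCount (wt : ℕ → ℕ) where

  weighted : ℕ → List ℕ → ℕ
  weighted K lam = sum (map (λ i → wt i ℕ.* mult i lam) (upTo K))

  weighted-single-≥ : ∀ x K → K ≤ x → weighted K [ x ] ≡ 0
  weighted-single-≥ x zero    _   = refl
  weighted-single-≥ x (suc K) K<x = begin
    weighted (suc K) [ x ]                     ≡⟨ sum-upTo-suc (λ i → wt i ℕ.* mult i [ x ]) K ⟩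
    weighted K [ x ] ℕ.+ wt K ℕ.* mult K [ x ] ≡⟨ cong₂ ℕ._+_ (weighted-single-≥ x K (ℕP.<⇒≤ K<x))
                                                      (cong (wt K ℕ.*_) (mult-other x K x≢K)) ⟩
    0 ℕ.+ wt K ℕ.* 0                           ≡⟨ ℕP.*-zeroʳ (wt K) ⟩
    0                                          ∎
    where
    open ≡-Reasoning
    x≢K : ¬ x ≡ K
    x≢K x≡K = ℕP.<-irrefl (sym x≡K) K<x

  weighted-single-< : ∀ x K → x < K → weighted K [ x ] ≡ wt x
  weighted-single-< x (suc K) x<1+K with x ≟ K
  ... | yes refl = begin
    weighted (suc x) [ x ]                     ≡⟨ sum-upTo-suc (λ i → wt i ℕ.* mult i [ x ]) x ⟩
    weighted x [ x ] ℕ.+ wt x ℕ.* mult x [ x ] ≡⟨ cong₂ ℕ._+_ (weighted-single-≥ x x ℕP.≤-refl)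
                                                      (cong (wt x ℕ.*_) (mult-self x)) ⟩
    wt x ℕ.* 1                                 ≡⟨ ℕP.*-identityʳ (wt x) ⟩
    wt x                                       ∎
    where open ≡-Reasoning
  ... | no x≢K = begin
    weighted (suc K) [ x ]                     ≡⟨ sum-upTo-suc (λ i → wt i ℕ.* mult i [ x ]) K ⟩
    weighted K [ x ] ℕ.+ wt K ℕ.* mult K [ x ] ≡⟨ cong₂ ℕ._+_ (weighted-single-< x K x<K)
                                                      (cong (wt K ℕ.*_) (mult-other x K x≢K)) ⟩
    wt x ℕ.+ wt K ℕ.* 0                        ≡⟨ cong (wt x ℕ.+_) (ℕP.*-zeroʳ (wt K)) ⟩
    wt x ℕ.+ 0                                 ≡⟨ ℕP.+-identityʳ (wt x) ⟩
    wt x                                       ∎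
    where
    open ≡-Reasoning
    x<K : x < K
    x<K = ℕP.≤∧≢⇒< (ℕP.≤-pred x<1+K) x≢K

  weighted-count : ∀ K lam → All (_< K) lam → weighted K lam ≡ sum (map wt lam)
  weighted-count K []        []           = sum-zero (upTo K)
    where
    sum-zero : ∀ is → sum (map (λ i → wt i ℕ.* 0) is) ≡ 0
    sum-zero []       = refl
    sum-zero (i ∷ is) = cong₂ ℕ._+_ (ℕP.*-zeroʳ (wt i)) (sum-zero is)
  weighted-count K (x ∷ lam) (x<K ∷ lam<K) = begin
    weighted K (x ∷ lam)
      ≡⟨ cong sum (map-cong split (upTo K)) ⟩
    sum (map (λ i → wt i ℕ.* mult i [ x ] ℕ.+ wt i ℕ.* mult i lam) (upTo K))
      ≡⟨ sum-map-+ (λ i → wt i ℕ.* mult i [ x ]) (λ i → wt i ℕ.* mult i lam) (upTo K) ⟩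
    weighted K [ x ] ℕ.+ weighted K lam
      ≡⟨ cong₂ ℕ._+_ (weighted-single-< x K x<K) (weighted-count K lam lam<K) ⟩
    wt x ℕ.+ sum (map wt lam) ∎
    where
    open ≡-Reasoning
    split : ∀ i → wt i ℕ.* mult i (x ∷ lam) ≡ wt i ℕ.* mult i [ x ] ℕ.+ wt i ℕ.* mult i lam
    split i = trans (cong (wt i ℕ.*_) (mult-∷ i x lam)) (ℕP.*-distribˡ-+ (wt i) _ _)

multiplicities : List ℕ → List ℕ
multiplicities lam = map (λ i → mult i lam) (upTo (suc (sum lam)))

multFact≡qfacts : ∀ lam → multFact lam ≡ qfacts (multiplicities lam)
multFact≡qfacts lam = cong prodP (map-∘ {g = qfact} {f = λ i → mult i lam} (upTo (suc (sum lam))))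

parts≤sum : ∀ lam → All (_≤ sum lam) lam
parts≤sum []        = []
parts≤sum (x ∷ lam) =
  ℕP.m≤m+n x (sum lam) ∷ All.map (λ y≤ → ℕP.≤-trans y≤ (ℕP.m≤n+m (sum lam) x)) (parts≤sum lam)

sum-multiplicities : ∀ lam → sum (multiplicities lam) ≡ length lam
sum-multiplicities lam = begin
  sum (map (λ i → mult i lam) (upTo (suc (sum lam))))
    ≡⟨ cong sum (map-cong (λ i → sym (ℕP.*-identityˡ (mult i lam))) (upTo (suc (sum lam)))) ⟩
  weighted (suc (sum lam)) lam
    ≡⟨ weighted-count (suc (sum lam)) lam (All.map s≤s (parts≤sum lam)) ⟩
  sum (map (λ _ → 1) lam)
    ≡⟨ sum-ones lam ⟩
  length lam ∎
  where
  open WeightedCount (λ _ → 1)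
  open ≡-Reasoning
  sum-ones : ∀ (xs : List ℕ) → sum (map (λ _ → 1) xs) ≡ length xs
  sum-ones []       = refl
  sum-ones (_ ∷ xs) = cong suc (sum-ones xs)

sum-weighted-multiplicities : ∀ lam → sum (map (λ i → i ℕ.* mult i lam) (upTo (suc (sum lam)))) ≡ sum lam
sum-weighted-multiplicities lam =
  trans (weighted-count (suc (sum lam)) lam (All.map s≤s (parts≤sum lam))) (cong sum (map-id lam))
  where open WeightedCount (λ i → i)

multFact-∣-qfact : ∀ lam → multFact lam ∣P qfact (length lam)
multFact-∣-qfact lam rewrite multFact≡qfacts lam | sym (sum-multiplicities lam) =
  qfacts-∣-qfact-sum (multiplicities lam)

-- [#parts]_q Π_i [m_i]_q! divides [Σ lam · M]_q [#parts]_q!: every m_i has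
-- this property by qfacts-∣-qint-part, and Σ lam · M = M · Σ_i i·m_i.
qint-multFact-∣ : ∀ lam M →
  (qint (length lam) *P multFact lam) ∣P (qint (sum lam ℕ.* M) *P qfact (length lam))
qint-multFact-∣ lam M rewrite multFact≡qfacts lam | sym (sum-multiplicities lam) | ℕP.*-comm (sum lam) M =
  divides-* M (sum lam) (subst Divides (sum-weighted-multiplicities lam) (divides-sum weighted-parts))
  where
  fs = multiplicities lam
  open QIntMultiples (qint (sum fs) *P qfacts fs) (qfact (sum fs))
  weighted-parts : All Divides (map (λ i → i ℕ.* mult i lam) (upTo (suc (sum lam))))
  weighted-parts = All.map⁺ (All.map (λ {i} → divides-* i (mult i lam))
                                     (All.map⁻ (All.tabulate (qfacts-∣-qint-part fs))))

length≤sum : ∀ lam → All (1 ≤_) lam → length lam ≤ sum lam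
length≤sum []        []           = z≤n
length≤sum (x ∷ lam) (1≤x ∷ 1≤lam) = ℕP.+-mono-≤ 1≤x (length≤sum lam 1≤lam)

module _ {N k lam} (par : IsPar N k lam) where
  open IsPar par

  nparts≤total : k ≤ N
  nparts≤total = subst₂ _≤_ nparts total (length≤sum lam positive)

  multinomial-∣ : multFact lam ∣P qfact k
  multinomial-∣ = subst (λ j → multFact lam ∣P qfact j) nparts (multFact-∣-qfact lam)

  scaled-multinomial-∣ : ∀ M → (qint k *P multFact lam) ∣P (qint (N ℕ.* M) *P qfact k)
  scaled-multinomial-∣ M =
    subst₂ (λ j T → (qint j *P multFact lam) ∣P (qint (T ℕ.* M) *P qfact j)) nparts total
           (qint-multFact-∣ lam M)

binomial-∣ : ∀ {r n} → r ≤ n → (qfact r *P qfact (n ∸ r)) ∣P qfact n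
binomial-∣ {r} {n} r≤n = subst (λ j → (qfact r *P qfact (n ∸ r)) ∣P qfact j) (ℕP.m+[n∸m]≡n r≤n)
                               (qfact-binomial r (n ∸ r))

reshape : ∀ a b₁ b₂ b₃ b₄ x y →
  (b₁ *P (b₂ *P (b₃ *P (b₄ *P ((a *P x) *P y))))) ≋ (a *P (b₁ *P (b₂ *P (b₃ *P (b₄ *P (x *P y))))))
reshape = solve-∀ polyRing

proposition2p8 : (n m c r s R S : ℕ) → 1 ≤ n → 1 ≤ m → 1 ≤ c →
    (α β lam μ : List ℕ) →
    IsPar R r α → IsPar S s β → IsPar (n ∸ R) c lam → IsPar (m ∸ S) c μ →
    IsPolynomial (X n m c r s R S α β lam μ)
proposition2p8 n m c r s R S _ _ 1≤c α β lam μ pα pβ pλ pμ =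
  divides⇒polynomial
    (∣P-resp (reshape (qint c) (qfact r *P qfact (n ∸ r)) (qfact s *P qfact (m ∸ s))
                      (multFact α) (multFact β) (multFact lam) (multFact μ))
             (reshape (qint ((n ∸ R) ℕ.* (m ∸ S))) (qfact n) (qfact m) (qfact r) (qfact s) (qfact c) (qfact c))
      (∣P-*-mono (binomial-∣ (ℕP.≤-trans (nparts≤total pα) (R≤n n R (nparts≤total pλ))))
      (∣P-*-mono (binomial-∣ (ℕP.≤-trans (nparts≤total pβ) (R≤n m S (nparts≤total pμ))))
      (∣P-*-mono (multinomial-∣ pα)
      (∣P-*-mono (multinomial-∣ pβ)
      (∣P-*-mono (scaled-multinomial-∣ pλ (m ∸ S)) (multinomial-∣ pμ)))))))
  where
  -- c ≥ 1 parts fit into n - R, so R < n.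
  R≤n : ∀ n R → c ≤ n ∸ R → R ≤ n
  R≤n n R c≤n∸R = ℕP.<⇒≤ (ℕP.m∸n≢0⇒n<m (ℕP.m<n⇒n≢0 (ℕP.≤-trans 1≤c c≤n∸R)))
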